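{- Let $G\in\mathscr{T}$ consist of $n$ triangles. Then the independence number of $G$ is $\alpha(G)=n$.
   Context: $\mathscr{T}$ is the class of simple graphs constructed as follows: take an even number of vertex-disjoint triangles (the set of triangle edges is $E_1(G)$), and then add edges (the set $E_2(G)$) so that every vertex of each triangle is joined by exactly one added edge to a vertex of a different triangle, yielding a 3-regular graph. The independence number $\alpha(G)$ is the maximum size of a set of pairwise nonadjacent vertices. -}

module Defs where

open import Data.Nat using (ℕ; _≤_)
open import Data.Fin using (Fin)
open import Data.Product using (_×_; _,_; proj₁; Σ-syntax)
open import Data.Sum using (_⊎_)
open import Data.List using (List; length)
open import Data.List.Membership.Propositional using (_∈_)
open import Data.List.Relation.Unary.Unique.Propositional using (Unique)
open import Relation.Binary.PropositionalEquality using (_≡_; _≢_)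
open import Relation.Nullary using (¬_)

-- Vertices of a graph in 𝒯 with n triangles: vertex (i , a) is corner a of triangle i.
V : ℕ → Set
V n = Fin n × Fin 3

-- A graph in 𝒯 with n triangles (up to isomorphism): the triangle edges E₁ join
-- distinct corners of the same triangle; the added edges E₂ form a perfect matching,
-- given by a fixed-point-free involution `match`, each vertex joined to exactly one
-- vertex (match v) of a different triangle.
record TGraph (n : ℕ) : Set where
  field
    match   : V n → V n
    invol   : ∀ v → match (match v) ≡ v
    diffTri : ∀ v → proj₁ (match v) ≢ proj₁ v

Adj : {n : ℕ} → TGraph n → V n → V n → Set
Adj G (i , a) (j , b) = (i ≡ j × a ≢ b) ⊎ (TGraph.match G (i , a) ≡ (j , b))

Independent : {n : ℕ} → TGraph n → List (V n) → Set
Independent G S = Unique S × (∀ u v → u ∈ S → v ∈ S → ¬ Adj G u v)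

IndependenceNumber : {n : ℕ} → TGraph n → ℕ → Set
IndependenceNumber G k =
  (Σ[ S ∈ List _ ] (Independent G S × length S ≡ k))
  × (∀ S → Independent G S → length S ≤ k)

-- Two corners of one triangle are adjacent, so an independent set meets every
-- triangle at most once and α(G) ≤ n.  For α(G) ≥ n we mark one corner per
-- triangle so that no E₂ edge joins two marked corners, using only two corners
-- h₁, h₂ of each triangle.  Deleting h₁ and h₂ and matching their E₂-partners
-- with each other leaves a smaller partial matching of the corners; a good
-- marking of it extends by marking h₁ if the partner of h₂ is marked, and h₂
-- otherwise.

module Submission where

open import Defs
open import Data.Nat using (ℕ; _≤_)
open import Data.Nat.Divisibility using (_∣_)

open import Data.Bool using (Bool; true; false; not; if_then_else_)
open import Data.Bool.Properties using (not-involutive)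
open import Data.Empty using (⊥-elim)
open import Data.Fin using (Fin; zero; suc; _≟_)
open import Data.Fin.Properties using (injective⇒≤)
open import Data.List using (List; []; _∷_; length; lookup; tabulate; allFin)
open import Data.List.Properties using (length-tabulate)
open import Data.List.Membership.Propositional using (_∈_)
open import Data.List.Membership.Propositional.Properties using (∈-lookup; ∈-tabulate⁻; ∈-allFin)
open import Data.List.Relation.Unary.Any using (here; there)
import Data.List.Relation.Unary.All as All
open import Data.List.Relation.Unary.AllPairs using (_∷_)
open import Data.List.Relation.Unary.Unique.Propositional using (Unique)
open import Data.List.Relation.Unary.Unique.Propositional.Properties using (tabulate⁺; allFin⁺)
open import Data.Product using (_×_; _,_; proj₁; proj₂; ∃-syntax)
open import Data.Product.Properties using (≡-dec)
open import Data.Sum using (_⊎_; inj₁; inj₂)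
open import Data.Unit using (⊤; tt)
open import Function using (_∘_)
open import Relation.Binary.Definitions using (DecidableEquality)
open import Relation.Binary.PropositionalEquality
open import Relation.Nullary using (¬_; Dec; does; yes; no)
open import Relation.Nullary.Decidable using (dec-true; dec-false)

lookup-injective : ∀ {A : Set} {xs : List A} → Unique xs →
                   ∀ i j → lookup xs i ≡ lookup xs j → i ≡ j
lookup-injective (_ ∷ _)     zero    zero    _ = refl
lookup-injective (x∉xs ∷ _)  zero    (suc j) e = ⊥-elim (All.lookup x∉xs (∈-lookup j) e)
lookup-injective (x∉xs ∷ _)  (suc i) zero    e = ⊥-elim (All.lookup x∉xs (∈-lookup i) (sym e))
lookup-injective (_ ∷ uxs)   (suc i) (suc j) e = cong suc (lookup-injective uxs i j e)

module HalfEdges {H A : Set} (_≟ᴴ_ : DecidableEquality H) (node : H → A) where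

  _[_≔_] : {B : Set} → (H → B) → H → B → H → B
  (f [ a ≔ x ]) h = if does (h ≟ᴴ a) then x else f h

  update-≡ : ∀ {B : Set} (f : H → B) a x → (f [ a ≔ x ]) a ≡ x
  update-≡ f a x = cong (if_then x else f a) (dec-true (a ≟ᴴ a) refl)

  update-≢ : ∀ {B : Set} (f : H → B) {a h} x → h ≢ a → (f [ a ≔ x ]) h ≡ f h
  update-≢ f {a} {h} x h≢a = cong (if_then x else f h) (dec-false (h ≟ᴴ a) h≢a)

  -- Case analysis on h ≟ᴴ a by 'with' would also abstract the tests inside
  -- _[_≔_], so it goes through this view instead.
  data Position (a b h : H) : Set where
    at-first  : h ≡ a → Position a b h
    at-second : h ≡ b → Position a b h
    elsewhere : h ≢ a → h ≢ b → Position a b h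

  position : ∀ a b h → Position a b h
  position a b h with h ≟ᴴ a | h ≟ᴴ b
  ... | yes h≡a | _       = at-first h≡a
  ... | no _    | yes h≡b = at-second h≡b
  ... | no h≢a  | no h≢b  = elsewhere h≢a h≢b

  record PartialMatching : Set₁ where
    field
      Live               : H → Set
      partner            : H → H
      partner-live       : ∀ {h} → Live h → Live (partner h)
      partner-involutive : ∀ {h} → Live h → partner (partner h) ≡ h
      partner-≢          : ∀ {h} → Live h → partner h ≢ h

    partner-injective : ∀ {a b} → Live a → Live b → partner a ≡ partner b → a ≡ b
    partner-injective la lb e =
      trans (sym (partner-involutive la)) (trans (cong partner e) (partner-involutive lb))

    partner-≢-partner : ∀ {a h} → Live h → h ≢ partner a → partner h ≢ a
    partner-≢-partner lh h≢pa e = h≢pa (trans (sym (partner-involutive lh)) (cong partner e))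

  open PartialMatching

  IndependentMarking : PartialMatching → (H → Bool) → Set
  IndependentMarking M T = ∀ {h} → Live M h → T h ≡ true → T (partner M h) ≡ false

  Covers : PartialMatching → (H → Bool) → List A → Set
  Covers M T R = ∀ {v} → v ∈ R → ∃[ h ] (Live M h × node h ≡ v × T h ≡ true)

  record LivePair (Live : H → Set) (v : A) : Set where
    field
      {first second} : H
      distinct       : first ≢ second
      first-live     : Live first
      second-live    : Live second
      first-at       : node first ≡ v
      second-at      : node second ≡ v

  module Splice (M : PartialMatching) {h₁ h₂ : H}
                (h₁≢h₂ : h₁ ≢ h₂) (l₁ : Live M h₁) (l₂ : Live M h₂) where

    private
      p : H → H
      p = partner M

      q₁ q₂ : H
      q₁ = p h₁
      q₂ = p h₂

      q₁≢q₂ : q₁ ≢ q₂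
      q₁≢q₂ = h₁≢h₂ ∘ partner-injective M l₁ l₂

    Live′ : H → Set
    Live′ h = Live M h × h ≢ h₁ × h ≢ h₂

    -- If h₁ and h₂ are partners of each other, splicing just deletes them.
    partner′ : H → H
    partner′ = (p [ q₂ ≔ q₁ ]) [ q₁ ≔ q₂ ]

    private
      partner′-q₁ : partner′ q₁ ≡ q₂
      partner′-q₁ = update-≡ (p [ q₂ ≔ q₁ ]) q₁ q₂

      partner′-q₂ : partner′ q₂ ≡ q₁
      partner′-q₂ = trans (update-≢ (p [ q₂ ≔ q₁ ]) q₂ (q₁≢q₂ ∘ sym)) (update-≡ p q₂ q₁)

      partner′-other : ∀ {h} → h ≢ q₁ → h ≢ q₂ → partner′ h ≡ p h
      partner′-other h≢q₁ h≢q₂ = trans (update-≢ (p [ q₂ ≔ q₁ ]) q₂ h≢q₁) (update-≢ p q₁ h≢q₂)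

      q₂≢h₁⇒q₁≢h₂ : q₂ ≢ h₁ → q₁ ≢ h₂
      q₂≢h₁⇒q₁≢h₂ q₂≢h₁ q₁≡h₂ = q₂≢h₁ (trans (cong p (sym q₁≡h₂)) (partner-involutive M l₁))

      q₁-live′ : q₁ ≢ h₂ → Live′ q₁
      q₁-live′ q₁≢h₂ = partner-live M l₁ , partner-≢ M l₁ , q₁≢h₂

      q₂-live′ : q₁ ≢ h₂ → Live′ q₂
      q₂-live′ q₁≢h₂ = partner-live M l₂ , partner-≢-partner M l₂ (q₁≢h₂ ∘ sym) , partner-≢ M l₂

      other-live′ : ∀ {h} → Live M h → h ≢ q₁ → h ≢ q₂ → Live′ (p h)
      other-live′ lh h≢q₁ h≢q₂ =
        partner-live M lh , partner-≢-partner M lh h≢q₁ , partner-≢-partner M lh h≢q₂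

      partner-avoids-q : ∀ {h} → Live′ h → p h ≢ q₁ × p h ≢ q₂
      partner-avoids-q (lh , h≢h₁ , h≢h₂) =
        h≢h₁ ∘ partner-injective M lh l₁ , h≢h₂ ∘ partner-injective M lh l₂

    spliced : PartialMatching
    spliced = record
      { Live               = Live′
      ; partner            = partner′
      ; partner-live       = live
      ; partner-involutive = involutive
      ; partner-≢          = irreflexive
      }
      where
      live : ∀ {h} → Live′ h → Live′ (partner′ h)
      live {h} (lh , h≢h₁ , h≢h₂) with position q₁ q₂ h
      ... | at-first refl  = subst Live′ (sym partner′-q₁) (q₂-live′ h≢h₂)
      ... | at-second refl = subst Live′ (sym partner′-q₂) (q₁-live′ (q₂≢h₁⇒q₁≢h₂ h≢h₁))
      ... | elsewhere h≢q₁ h≢q₂ =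
        subst Live′ (sym (partner′-other h≢q₁ h≢q₂)) (other-live′ lh h≢q₁ h≢q₂)

      involutive : ∀ {h} → Live′ h → partner′ (partner′ h) ≡ h
      involutive {h} lh′ with position q₁ q₂ h
      ... | at-first refl  = trans (cong partner′ partner′-q₁) partner′-q₂
      ... | at-second refl = trans (cong partner′ partner′-q₂) partner′-q₁
      ... | elsewhere h≢q₁ h≢q₂ = let (ph≢q₁ , ph≢q₂) = partner-avoids-q lh′ in
        begin
          partner′ (partner′ h) ≡⟨ cong partner′ (partner′-other h≢q₁ h≢q₂) ⟩
          partner′ (p h)        ≡⟨ partner′-other ph≢q₁ ph≢q₂ ⟩
          p (p h)               ≡⟨ partner-involutive M (proj₁ lh′) ⟩
          h                     ∎
        where open ≡-Reasoning

      irreflexive : ∀ {h} → Live′ h → partner′ h ≢ h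
      irreflexive {h} (lh , _) with position q₁ q₂ h
      ... | at-first refl  = q₁≢q₂ ∘ sym ∘ trans (sym partner′-q₁)
      ... | at-second refl = q₁≢q₂ ∘ trans (sym partner′-q₂)
      ... | elsewhere h≢q₁ h≢q₂ = partner-≢ M lh ∘ trans (sym (partner′-other h≢q₁ h≢q₂))

    module Extend (T′ : H → Bool) (T′-independent : IndependentMarking spliced T′) where

      private
        b : Bool
        b = T′ q₂

      T : H → Bool
      T = (T′ [ h₂ ≔ not b ]) [ h₁ ≔ b ]

      private
        T-h₁ : T h₁ ≡ b
        T-h₁ = update-≡ (T′ [ h₂ ≔ not b ]) h₁ b

        T-h₂ : T h₂ ≡ not b
        T-h₂ = trans (update-≢ (T′ [ h₂ ≔ not b ]) b (h₁≢h₂ ∘ sym)) (update-≡ T′ h₂ (not b))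

        not≡true : ∀ {x} → not x ≡ true → x ≡ false
        not≡true {x} e = trans (sym (not-involutive x)) (cong not e)

      T-other : ∀ {h} → h ≢ h₁ → h ≢ h₂ → T h ≡ T′ h
      T-other h≢h₁ h≢h₂ = trans (update-≢ (T′ [ h₂ ≔ not b ]) b h≢h₁) (update-≢ T′ (not b) h≢h₂)

      T-marks-pair : T h₁ ≡ true ⊎ T h₂ ≡ true
      T-marks-pair = marks b refl
        where
        marks : ∀ x → b ≡ x → T h₁ ≡ true ⊎ T h₂ ≡ true
        marks true  b≡x = inj₁ (trans T-h₁ b≡x)
        marks false b≡x = inj₂ (trans T-h₂ (cong not b≡x))

      private
        after-h₁ : b ≡ true → T q₁ ≡ false
        after-h₁ b≡true = after-h₁′ (q₁ ≟ᴴ h₂)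
          where
          after-h₁′ : Dec (q₁ ≡ h₂) → T q₁ ≡ false
          after-h₁′ (yes q₁≡h₂) = trans (cong T q₁≡h₂) (trans T-h₂ (cong not b≡true))
          after-h₁′ (no q₁≢h₂)  = begin
            T q₁              ≡⟨ T-other (partner-≢ M l₁) q₁≢h₂ ⟩
            T′ q₁             ≡⟨ cong T′ (sym partner′-q₂) ⟩
            T′ (partner′ q₂)  ≡⟨ T′-independent (q₂-live′ q₁≢h₂) b≡true ⟩
            false             ∎
            where open ≡-Reasoning

        after-h₂ : not b ≡ true → T q₂ ≡ false
        after-h₂ not-b≡true = after-h₂′ (q₂ ≟ᴴ h₁)
          where
          after-h₂′ : Dec (q₂ ≡ h₁) → T q₂ ≡ false
          after-h₂′ (yes q₂≡h₁) = trans (cong T q₂≡h₁) (trans T-h₁ (not≡true not-b≡true))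
          after-h₂′ (no q₂≢h₁)  = trans (T-other q₂≢h₁ (partner-≢ M l₂)) (not≡true not-b≡true)

        after-other : ∀ {h} → Live′ h → T′ h ≡ true → T (p h) ≡ false
        after-other {h} lh′ T′h with position q₁ q₂ h
        ... | at-first refl  = begin
          T (p q₁)          ≡⟨ cong T (partner-involutive M l₁) ⟩
          T h₁              ≡⟨ T-h₁ ⟩
          T′ q₂             ≡⟨ cong T′ (sym partner′-q₁) ⟩
          T′ (partner′ q₁)  ≡⟨ T′-independent lh′ T′h ⟩
          false             ∎
          where open ≡-Reasoning
        ... | at-second refl =
          trans (cong T (partner-involutive M l₂)) (trans T-h₂ (cong not T′h))
        ... | elsewhere h≢q₁ h≢q₂ = let (_ , ph≢h₁ , ph≢h₂) = other-live′ (proj₁ lh′) h≢q₁ h≢q₂ in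
          begin
          T (p h)           ≡⟨ T-other ph≢h₁ ph≢h₂ ⟩
          T′ (p h)          ≡⟨ cong T′ (sym (partner′-other h≢q₁ h≢q₂)) ⟩
          T′ (partner′ h)   ≡⟨ T′-independent lh′ T′h ⟩
          false             ∎
          where open ≡-Reasoning

      T-independent : IndependentMarking M T
      T-independent {h} lh Th with position h₁ h₂ h
      ... | at-first refl  = after-h₁ (trans (sym T-h₁) Th)
      ... | at-second refl = after-h₂ (trans (sym T-h₂) Th)
      ... | elsewhere h≢h₁ h≢h₂ = after-other (lh , h≢h₁ , h≢h₂) (trans (sym (T-other h≢h₁ h≢h₂)) Th)

  mark : (M : PartialMatching) (R : List A) → Unique R → (∀ {v} → v ∈ R → LivePair (Live M) v) →
         ∃[ T ] (IndependentMarking M T × Covers M T R)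
  mark M []      _                   _     = (λ _ → false) , (λ _ ()) , λ ()
  mark M (v ∷ R) (v∉R ∷ R-unique) pairs = T , T-independent , covers
    where
    open LivePair (pairs (here refl))
    open Splice M distinct first-live second-live

    live′ : ∀ {h w} → w ∈ R → Live M h → node h ≡ w → Live′ h
    live′ w∈R lh h-at = lh , (λ { refl → v≢w (trans (sym first-at) h-at) })
                           , (λ { refl → v≢w (trans (sym second-at) h-at) })
      where
      v≢w = All.lookup v∉R w∈R

    pairs′ : ∀ {w} → w ∈ R → LivePair Live′ w
    pairs′ w∈R = let P = pairs (there w∈R) in record
      { distinct    = LivePair.distinct P
      ; first-live  = live′ w∈R (LivePair.first-live P) (LivePair.first-at P)
      ; second-live = live′ w∈R (LivePair.second-live P) (LivePair.second-at P)
      ; first-at    = LivePair.first-at P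
      ; second-at   = LivePair.second-at P
      }

    smaller = mark spliced R R-unique pairs′
    open Extend (proj₁ smaller) (proj₁ (proj₂ smaller))

    covers : Covers M T (v ∷ R)
    covers (here refl) with T-marks-pair
    ... | inj₁ T-first  = first , first-live , first-at , T-first
    ... | inj₂ T-second = second , second-live , second-at , T-second
    covers (there w∈R) with proj₂ (proj₂ smaller) w∈R
    ... | h , (lh , h≢h₁ , h≢h₂) , h-at , T′h = h , lh , h-at , trans (T-other h≢h₁ h≢h₂) T′h

module _ {n : ℕ} (G : TGraph n) where
  open TGraph G
  open HalfEdges {V n} {Fin n} (≡-dec _≟_ _≟_) proj₁

  added-edges : PartialMatching
  added-edges = record
    { Live               = λ _ → ⊤
    ; partner            = match
    ; partner-live       = λ _ → tt
    ; partner-involutive = λ {h} _ → invol h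
    ; partner-≢          = λ {h} _ → diffTri h ∘ cong proj₁
    }

  two-corners : ∀ {i} → i ∈ allFin n → LivePair (λ _ → ⊤) i
  two-corners {i} _ = record
    { first = i , zero ; second = i , suc zero ; distinct = λ ()
    ; first-live = tt ; second-live = tt ; first-at = refl ; second-at = refl }

  independent-transversal : ∃[ S ] (Independent G S × length S ≡ n)
  independent-transversal = tabulate pick , (tabulate⁺ (cong proj₁) , independent) , length-tabulate pick
    where
    marking = mark added-edges (allFin n) (allFin⁺ n) two-corners
    T = proj₁ marking

    marked-corner : ∀ i → ∃[ h ] (⊤ × proj₁ h ≡ i × T h ≡ true)
    marked-corner i = proj₂ (proj₂ marking) (∈-allFin i)

    pick : Fin n → V n
    pick i = i , proj₂ (proj₁ (marked-corner i))

    pick-marked : ∀ i → T (pick i) ≡ true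
    pick-marked i with marked-corner i
    ... | _ , _ , refl , T-marked = T-marked

    independent : ∀ u w → u ∈ tabulate pick → w ∈ tabulate pick → ¬ Adj G u w
    independent u w u∈ w∈ with ∈-tabulate⁻ u∈ | ∈-tabulate⁻ w∈
    ... | i , refl | j , refl = λ
      { (inj₁ (refl , corners≢)) → corners≢ refl
      ; (inj₂ matched) → true≢false (trans (sym (pick-marked j))
          (trans (cong T (sym matched)) (proj₁ (proj₂ marking) tt (pick-marked i)))) }
      where
      true≢false : true ≢ false
      true≢false ()

  at-most-one-per-triangle : ∀ S → Independent G S → length S ≤ n
  at-most-one-per-triangle S (S-unique , S-independent) = injective⇒≤ triangle-injective
    where
    triangle-injective : ∀ {k l} → proj₁ (lookup S k) ≡ proj₁ (lookup S l) → k ≡ l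
    triangle-injective {k} {l} same-triangle with proj₂ (lookup S k) ≟ proj₂ (lookup S l)
    ... | yes same-corner = lookup-injective S-unique k l (cong₂ _,_ same-triangle same-corner)
    ... | no corners≢     =
      ⊥-elim (S-independent _ _ (∈-lookup k) (∈-lookup l) (inj₁ (same-triangle , corners≢)))

lemma1 : (n : ℕ) → 2 ∣ n → (G : TGraph n) → IndependenceNumber G n
lemma1 n _ G = independent-transversal G , at-most-one-per-triangle G
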